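{- For every base $\mathcal{B}$, atomic multiset $L$ and formulae $\varphi,\psi$: if $\Vdash^{\varnothing}_{\mathcal{B}}\varphi$, then for every base $\mathcal{C}\supseteq\mathcal{B}$ such that $!\varphi\Vdash^{L}_{\mathcal{C}}\psi$, we have $\Vdash^{L}_{\mathcal{C}}\psi$.
   Context: Fix a set $\mathbb{A}$ of propositional atoms. All multisets are finite; $\uplus$ denotes multiset union; an atomic multiset is a finite multiset of atoms. Formulae: $\varphi ::= p\in\mathbb{A}\mid\top\mid 0\mid 1\mid\varphi\multimap\varphi\mid\varphi\otimes\varphi\mid\varphi\mathbin{\&}\varphi\mid\varphi\oplus\varphi\mid\,!\varphi$. Bases. An atomic sequent is a pair $P\Rightarrow p$ ($P$ atomic multiset, $p$ atom); an atomic box is a finite multiset of atomic sequents; an atomic rule is a triple $\langle\mathbf{A},\mathbf{S},p\rangle$ with $\mathbf{A}$ a finite multiset of atomic boxes, $\mathbf{S}$ an atomic box, $p$ an atom. A base is a set of atomic rules; $\mathcal{C}\supseteq\mathcal{B}$ is set inclusion. An atom $p$ is persistent in $\mathcal{B}$ if $\mathcal{B}$ contains a rule $\langle\varnothing,\mathbf{S},p\rangle$ with $\mathbf{S}\neq\varnothing$. Derivability $P\vdash_{\mathcal{B}}p$ is the smallest relation closed under: (Ref) $\{p\}\vdash_{\mathcal{B}}p$; (App) if $\langle\mathbf{A},\mathbf{S},p\rangle\in\mathcal{B}$ with $\mathbf{A}=\{\mathbf{T}_1,\dots,\mathbf{T}_m\}$, and there are $n\ge m$, atomic multisets $C_1,\dots,C_n$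 and a multiset $D=\{d_{m+1},\dots,d_n\}$ of atoms persistent in $\mathcal{B}$ with $C_i\uplus Q\vdash_{\mathcal{B}}q$ for all $i\le m$ and $Q\Rightarrow q\in\mathbf{T}_i$, $C_j\vdash_{\mathcal{B}}d_j$ for all $m<j\le n$, and $D\uplus U\vdash_{\mathcal{B}}v$ for all $U\Rightarrow v\in\mathbf{S}$, then $C_1\uplus\dots\uplus C_n\vdash_{\mathcal{B}}p$. Support. For a base $\mathcal{B}$, atomic multiset $L$: (At) $\Vdash^L_{\mathcal{B}}p$ iff $L\vdash_{\mathcal{B}}p$; ($\multimap$) $\Vdash^L_{\mathcal{B}}\varphi\multimap\psi$ iff $\varphi\Vdash^L_{\mathcal{B}}\psi$; ($\otimes$) $\Vdash^L_{\mathcal{B}}\varphi\otimes\psi$ iff for all $\mathcal{C}\supseteq\mathcal{B}$, atomic multisets $K$, atoms $p$: if $\{\varphi,\psi\}\Vdash^K_{\mathcal{C}}p$ then $\Vdash^{L\uplus K}_{\mathcal{C}}p$; ($1$) $\Vdash^L_{\mathcal{B}}1$ iff for all $\mathcal{C}\supseteq\mathcal{B}$, $K$, $p$: if $\Vdash^K_{\mathcal{C}}p$ then $\Vdash^{L\uplus K}_{\mathcal{C}}p$; ($\mathbin{\&}$) $\Vdash^L_{\mathcal{B}}\varphi\mathbin{\&}\psi$ iff $\Vdash^L_{\mathcal{B}}\varphi$ and $\Vdash^L_{\mathcal{B}}\psi$; ($\oplus$) $\Vdash^L_{\mathcal{B}}\varphi\oplus\psi$ iff for all $\mathcal{C}\supseteq\mathcal{B}$,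 $K$, $p$: if $\varphi\Vdash^K_{\mathcal{C}}p$ and $\psi\Vdash^K_{\mathcal{C}}p$ then $\Vdash^{L\uplus K}_{\mathcal{C}}p$; ($0$) $\Vdash^L_{\mathcal{B}}0$ iff $\Vdash^{L\uplus K}_{\mathcal{B}}p$ for all atoms $p$ and atomic multisets $K$; ($\top$) $\Vdash^L_{\mathcal{B}}\top$ always; ($!$) $\Vdash^L_{\mathcal{B}}\,!\varphi$ iff for all $\mathcal{C}\supseteq\mathcal{B}$, $K$, $p$: if (for all $\mathcal{D}\supseteq\mathcal{C}$, $\Vdash^{\varnothing}_{\mathcal{D}}\varphi$ implies $\Vdash^K_{\mathcal{D}}p$) then $\Vdash^{L\uplus K}_{\mathcal{C}}p$. Multisets: $\Vdash^L_{\mathcal{B}}\varnothing$ iff $L=\varnothing$; $\Vdash^L_{\mathcal{B}}\{\varphi\}$ iff $\Vdash^L_{\mathcal{B}}\varphi$; $\Vdash^L_{\mathcal{B}}\Gamma\uplus\Delta$ iff $L=K\uplus M$ for some $K,M$ with $\Vdash^K_{\mathcal{B}}\Gamma$, $\Vdash^M_{\mathcal{B}}\Delta$. (Inf) For non-empty $\Gamma$, write $\Gamma=\,!\Delta\uplus\Theta$ with $!\Delta$ the elements whose top-level connective is $!$ and $\Theta$ the rest; $\Gamma\Vdash^L_{\mathcal{B}}\varphi$ iff for all $\mathcal{C}\supseteq\mathcal{B}$ and atomic $K$: if $\Vdash^{\varnothing}_{\mathcal{C}}\delta$ for every $\delta\in\Delta$ and $\Vdash^K_{\mathcal{C}}\Theta$,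 then $\Vdash^{L\uplus K}_{\mathcal{C}}\varphi$. For $\Gamma=\varnothing$, $\Gamma\Vdash^L_{\mathcal{B}}\varphi$ means $\Vdash^L_{\mathcal{B}}\varphi$. -}

module Defs where

open import Level using (Level; Lift; lift; 0ℓ) renaming (suc to lsuc)
open import Data.Nat using (ℕ)
open import Data.Fin using (Fin)
open import Data.List using (List; []; _∷_; _++_; concat; tabulate; map; length; lookup)
open import Data.List.Membership.Propositional using (_∈_)
open import Data.List.Relation.Binary.Permutation.Propositional using (_↭_)
open import Data.Product using (Σ; _×_; _,_)
open import Data.Unit.Polymorphic using (⊤)
open import Relation.Binary.PropositionalEquality using (_≡_; _≢_)
open import Relation.Unary using (Pred; _⊆_)

-- Everything is parametrised by the set 𝔸 of propositional atoms.
-- Finite multisets are represented by lists; multiset union is _++_,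
-- and multiset equality is permutation _↭_.
module _ (Atom : Set) where

  record Sequent : Set where
    constructor _⇒_
    field
      ante : List Atom
      succ : Atom
  open Sequent public

  Box : Set
  Box = List Sequent

  record Rule : Set where
    constructor ⟨_,_,_⟩
    field
      prems  : List Box
      disch  : Box
      concl  : Atom
  open Rule public

  -- a base is a set of atomic rules; C ⊇ B is  B ⊆ C  (set inclusion)
  Base : Set₁
  Base = Pred Rule 0ℓ

  Persistent : Base → Atom → Set
  Persistent B p = Σ Box λ S → (S ≢ []) × B ⟨ [] , S , p ⟩

  data Deriv (B : Base) : List Atom → Atom → Set where
    ref : ∀ {p} → Deriv B (p ∷ []) p
    app : ∀ {A S p Γ} → B ⟨ A , S , p ⟩ →
          -- C_1 … C_m, one for each premise box T_i of A
          (Cs : Fin (length A) → List Atom) →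
          (∀ i {s} → s ∈ lookup A i → Deriv B (Cs i ++ ante s) (succ s)) →
          -- C_{m+1} … C_n and persistent atoms d_{m+1} … d_n
          (k : ℕ) (Es : Fin k → List Atom) (ds : Fin k → Atom) →
          (∀ j → Persistent B (ds j)) →
          (∀ j → Deriv B (Es j) (ds j)) →
          (∀ {s} → s ∈ S → Deriv B (tabulate ds ++ ante s) (succ s)) →
          Γ ↭ concat (tabulate Cs ++ tabulate Es) →
          Deriv B Γ p

  infixr 5 _⊸_
  infixr 6 _⊗_ _&_ _⊕_
  infix 7 !_
  data Formula : Set where
    atom : Atom → Formula
    top  : Formula
    𝟘    : Formula
    𝟙    : Formula
    _⊸_  : Formula → Formula → Formula
    _⊗_  : Formula → Formula → Formula
    _&_  : Formula → Formula → Formula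
    _⊕_  : Formula → Formula → Formula
    !_   : Formula → Formula

  -- semantic values: support predicates  (B , L) ↦ ⊩^L_B …
  SuppP : Set₂
  SuppP = Base → List Atom → Set₁

  -- a hypothesis in the antecedent of (Inf): either !δ (carrying ⟦δ⟧) or
  -- a non-! formula (carrying its own support predicate)
  data Hyp : Set₂ where
    bang  : SuppP → Hyp
    plain : SuppP → Hyp

  MS : List SuppP → Base → List Atom → Set₁
  MS []       B L = Lift (lsuc 0ℓ) (L ↭ [])
  MS (s ∷ ss) B L = Σ (List Atom) λ K → Σ (List Atom) λ M →
                      Lift (lsuc 0ℓ) (L ↭ K ++ M) × s B K × MS ss B M

  BangsOK : List Hyp → Base → Set₁
  BangsOK []              C = ⊤
  BangsOK (bang s  ∷ hs)  C = s C [] × BangsOK hs C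
  BangsOK (plain _ ∷ hs)  C = BangsOK hs C

  plains : List Hyp → List SuppP
  plains []             = []
  plains (bang _  ∷ hs) = plains hs
  plains (plain s ∷ hs) = s ∷ plains hs

  InfH : List Hyp → SuppP → SuppP
  InfH []         S B L = S B L
  InfH hs@(_ ∷ _) S B L = ∀ (C : Base) → B ⊆ C → ∀ (K : List Atom) →
                            BangsOK hs C → MS (plains hs) C K → S C (L ++ K)

  AtS : Atom → SuppP
  AtS p B L = Lift (lsuc 0ℓ) (Deriv B L p)

  mutual
    ⟦_⟧ : Formula → SuppP
    ⟦ atom p ⟧ B L = AtS p B L
    ⟦ φ ⊸ ψ ⟧  B L = InfH (hypOf φ ∷ []) ⟦ ψ ⟧ B L
    ⟦ φ ⊗ ψ ⟧  B L = ∀ (C : Base) → B ⊆ C → ∀ (K : List Atom) (p : Atom) →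
                       InfH (hypOf φ ∷ hypOf ψ ∷ []) (AtS p) C K → AtS p C (L ++ K)
    ⟦ 𝟙 ⟧      B L = ∀ (C : Base) → B ⊆ C → ∀ (K : List Atom) (p : Atom) →
                       AtS p C K → AtS p C (L ++ K)
    ⟦ φ & ψ ⟧  B L = ⟦ φ ⟧ B L × ⟦ ψ ⟧ B L
    ⟦ φ ⊕ ψ ⟧  B L = ∀ (C : Base) → B ⊆ C → ∀ (K : List Atom) (p : Atom) →
                       InfH (hypOf φ ∷ []) (AtS p) C K →
                       InfH (hypOf ψ ∷ []) (AtS p) C K → AtS p C (L ++ K)
    ⟦ 𝟘 ⟧      B L = ∀ (p : Atom) (K : List Atom) → AtS p B (L ++ K)
    ⟦ top ⟧    B L = ⊤
    ⟦ ! φ ⟧    B L = ∀ (C : Base) → B ⊆ C → ∀ (K : List Atom) (p : Atom) →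
                       (∀ (D : Base) → C ⊆ D → ⟦ φ ⟧ D [] → AtS p D K) →
                       AtS p C (L ++ K)

    hypOf : Formula → Hyp
    hypOf (! δ) = bang ⟦ δ ⟧
    hypOf φ     = plain ⟦ φ ⟧

  Sup : Base → List Atom → Formula → Set₁
  Sup B L φ = ⟦ φ ⟧ B L

  Inf : Base → List Atom → List Formula → Formula → Set₁
  Inf B L Γ φ = InfH (map hypOf Γ) ⟦ φ ⟧ B L

module Submission where

open import Defs
open import Data.List using (List; []; _∷_; _++_)
open import Data.List.Properties using (++-identityʳ)
open import Data.List.Relation.Binary.Permutation.Propositional using (↭-refl)
open import Data.Product using (_,_)
open import Level using (lift; lower)
open import Relation.Binary.PropositionalEquality using (subst)
open import Relation.Unary using (_⊆_)

-- Support is monotone in the base: atomic derivability is, and every other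
-- clause either recurses structurally or already quantifies over all extensions.
-- With ⊩^∅_C φ in hand, instantiate the (Inf) clause of !φ ⊩^L_C ψ at C itself
-- with the empty multiset for the (empty) non-! part.

module _ {Atom : Set} where

  Persistent-mono : ∀ {B C : Base Atom} → B ⊆ C → ∀ {p} →
                    Persistent Atom B p → Persistent Atom C p
  Persistent-mono B⊆C (S , S≢[] , r) = S , S≢[] , B⊆C r

  Deriv-mono : ∀ {B C : Base Atom} → B ⊆ C → ∀ {L p} →
               Deriv Atom B L p → Deriv Atom C L p
  Deriv-mono B⊆C ref = ref
  Deriv-mono B⊆C (app r Cs dsT k Es ds pers dsE dsS perm) =
    app (B⊆C r) Cs (λ i s∈T → Deriv-mono B⊆C (dsT i s∈T)) k Es ds
        -- eta-expanded so that the implicit rule argument of _⊆_ is not instantiated early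
        (λ j → Persistent-mono (λ {r} → B⊆C {r}) (pers j))
        (λ j → Deriv-mono B⊆C (dsE j)) (λ s∈S → Deriv-mono B⊆C (dsS s∈S)) perm

  ⟦⟧-mono : ∀ (φ : Formula Atom) {B C : Base Atom} → B ⊆ C → ∀ {L} →
            ⟦_⟧ Atom φ B L → ⟦_⟧ Atom φ C L
  ⟦⟧-mono (atom p) B⊆C (lift d) = lift (Deriv-mono B⊆C d)
  ⟦⟧-mono top      B⊆C tt      = tt
  ⟦⟧-mono 𝟘        B⊆C f p K   = lift (Deriv-mono B⊆C (lower (f p K)))
  ⟦⟧-mono 𝟙        B⊆C f D C⊆D = f D (λ r → C⊆D (B⊆C r))
  ⟦⟧-mono (φ ⊸ ψ)  B⊆C f D C⊆D = f D (λ r → C⊆D (B⊆C r))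
  ⟦⟧-mono (φ ⊗ ψ)  B⊆C f D C⊆D = f D (λ r → C⊆D (B⊆C r))
  ⟦⟧-mono (φ & ψ)  B⊆C (a , b) = ⟦⟧-mono φ B⊆C a , ⟦⟧-mono ψ B⊆C b
  ⟦⟧-mono (φ ⊕ ψ)  B⊆C f D C⊆D = f D (λ r → C⊆D (B⊆C r))
  ⟦⟧-mono (! φ)    B⊆C f D C⊆D = f D (λ r → C⊆D (B⊆C r))

mainTheorem13 : (Atom : Set) (B : Base Atom) (L : List Atom) (φ ψ : Formula Atom) →
    Sup Atom B [] φ →
    (C : Base Atom) → B ⊆ C → Inf Atom C L (! φ ∷ []) ψ → Sup Atom C L ψ
mainTheorem13 Atom B L φ ψ ⊩φ C B⊆C !φ⊩ψ =
  subst (⟦_⟧ Atom ψ C) (++-identityʳ L)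
    (!φ⊩ψ C (λ r → r) [] (⟦⟧-mono φ B⊆C ⊩φ , _) (lift ↭-refl))
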